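{- Let $G$, the palettes, $\epsilon$ and the initial coloring step be as in the context, and let $v$ be a sparse vertex. Then with probability one, $S_0(v)\ge |J|$, where $J$ is the set of colors that are good for $v$.
   Context: Let $G=(V,E)$ be a finite simple graph with maximum degree $\Delta$ and neighborhoods $N(v)$. Each vertex $v$ has a palette $\operatorname{Pal}(v)$ of exactly $\Delta+1$ colors; $0$ is a blank color. Fix $\epsilon\in(0,1/5)$. An edge $uv$ is a friend edge if $|N(u)\cap N(v)|\ge(1-\epsilon)\Delta$; a vertex is sparse if it has fewer than $(1-\epsilon)\Delta$ friends. Initial coloring step: independently, each vertex sets $A(v)=0$ with probability $99/100$ and otherwise chooses $A(v)$ uniformly from $\operatorname{Pal}(v)$; then $\chi(v)=A(v)$ if $A(v)\ne0$ and no neighbor $w$ has $A(w)=A(v)$, else $\chi(v)=0$. Afterwards $Q_0(v)=|\operatorname{Pal}(v)\setminus\{\chi(w):w\in N(v)\}|$, $d_0(v)=|\{w\in N(v):\chi(w)=0\}|$, $S_0(v)=Q_0(v)-d_0(v)$. A color $c\neq 0$ is good for $v$ if $|\{w\in N(v):\chi(w)=c\}|\ge 1+[c\in\operatorname{Pal}(v)]$, where $[P]$ is $1$ if $P$ holds and $0$ otherwise.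
   Formalization: The parameter $\epsilon$ ranges over the rationals in $(0,1/5)$ rather than over the reals. -}

module Defs where

open import Data.Nat using (ℕ; zero; suc; _≤_; _<_; _≡ᵇ_; _+_)
open import Data.Bool using (Bool; true; false; _∧_; not; if_then_else_)
open import Data.Fin using (Fin)
open import Data.List using (List; length; filterᵇ; allFin)
open import Data.Bool.ListAction using (any)
open import Data.List.Membership.Propositional using (_∈_)
open import Data.List.Relation.Unary.Unique.Propositional using (Unique)
open import Data.List.Relation.Unary.All using (All)
open import Data.Integer using (ℤ; +_; _-_)
open import Data.Rational using (ℚ; _/_; 1ℚ) renaming (_-_ to _-ℚ_; _*_ to _*ℚ_; _≤_ to _≤ℚ_; _<_ to _<ℚ_)
open import Data.Product using (_×_; ∃)
open import Relation.Binary.PropositionalEquality using (_≡_; _≢_)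

record Graph (n : ℕ) : Set where
  field
    adj    : Fin n → Fin n → Bool
    sym    : ∀ u w → adj u w ≡ adj w u
    irrefl : ∀ u → adj u u ≡ false
open Graph public

module _ {n : ℕ} (G : Graph n) where

  nbrs : Fin n → List (Fin n)
  nbrs v = filterᵇ (adj G v) (allFin n)

  deg : Fin n → ℕ
  deg v = length (nbrs v)

  IsMaxDegree : ℕ → Set
  IsMaxDegree Δ = (∀ v → deg v ≤ Δ) × ∃ (λ v → deg v ≡ Δ)

  common : Fin n → Fin n → ℕ
  common u w = length (filterᵇ (λ x → adj G u x ∧ adj G w x) (allFin n))

  ℕtoℚ : ℕ → ℚ
  ℕtoℚ k = + k / 1

  FriendEdge : ℚ → ℕ → Fin n → Fin n → Set
  FriendEdge ε Δ u w = (adj G u w ≡ true) × ((1ℚ -ℚ ε) *ℚ ℕtoℚ Δ ≤ℚ ℕtoℚ (common u w))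

  friendᵇ : ℚ → ℕ → Fin n → Fin n → Bool
  friendᵇ ε Δ u w = adj G u w ∧ Data.Rational._≤ᵇ_ ((1ℚ -ℚ ε) *ℚ ℕtoℚ Δ) (ℕtoℚ (common u w))
    where import Data.Rational

  friends : ℚ → ℕ → Fin n → List (Fin n)
  friends ε Δ v = filterᵇ (friendᵇ ε Δ v) (allFin n)

  Sparse : ℚ → ℕ → Fin n → Set
  Sparse ε Δ v = ℕtoℚ (length (friends ε Δ v)) <ℚ (1ℚ -ℚ ε) *ℚ ℕtoℚ Δ

  ValidPalettes : ℕ → (Fin n → List ℕ) → Set
  ValidPalettes Δ pal = ∀ v → Unique (pal v) × (length (pal v) ≡ suc Δ) × All (λ c → c ≢ 0) (pal v)

  -- outcome A of the random choices lies in the support of the distribution: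
  -- A(v) = 0 or A(v) ∈ Pal(v)

  memᵇ : ℕ → List ℕ → Bool
  memᵇ c l = any (λ d → c ≡ᵇ d) l

  InSupport : (Fin n → List ℕ) → (Fin n → ℕ) → Set
  InSupport pal A = ∀ v → (A v ≡ 0) Data.Sum.⊎ (A v ∈ pal v)
    where import Data.Sum

  χ : (Fin n → ℕ) → Fin n → ℕ
  χ A v = if not (A v ≡ᵇ 0) ∧ not (any (λ w → adj G v w ∧ (A w ≡ᵇ A v)) (allFin n))
          then A v else 0

  Q₀ : (Fin n → List ℕ) → (Fin n → ℕ) → Fin n → ℕ
  Q₀ pal A v = length (filterᵇ (λ c → not (any (λ w → χ A w ≡ᵇ c) (nbrs v))) (pal v))

  d₀ : (Fin n → ℕ) → Fin n → ℕ
  d₀ A v = length (filterᵇ (λ w → χ A w ≡ᵇ 0) (nbrs v))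

  S₀ : (Fin n → List ℕ) → (Fin n → ℕ) → Fin n → ℤ
  S₀ pal A v = + Q₀ pal A v - + d₀ A v

  Good : (Fin n → List ℕ) → (Fin n → ℕ) → Fin n → ℕ → Set
  Good pal A v c = (c ≢ 0) ×
    (1 + (if memᵇ c (pal v) then 1 else 0) ≤ length (filterᵇ (λ w → χ A w ≡ᵇ c) (nbrs v)))

-- Fix v and let the neighbours w of v arrive one at a time. The quantity
-- |J| + d₀(v) + |Pal(v)| - Q₀(v) grows by at most one per neighbour: a neighbour
-- of colour 0 raises d₀ only; a neighbour whose colour is still free in Pal(v)
-- lowers Q₀ only, and that colour is then seen once, so it cannot be good; any
-- other neighbour can add at most its own colour to J. Hence
-- |J| + d₀ + |Pal(v)| ≤ Q₀ + deg v, and deg v ≤ Δ < |Pal(v)| gives |J| ≤ Q₀ - d₀.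
-- The bound holds for every outcome of the random step.
module Submission where

open import Defs hiding (sym)
open import Data.Nat using (ℕ; suc; _+_; _≤_; _≡ᵇ_; _≟_; z≤n; s≤s)
open import Data.Nat.Properties
open import Data.Nat.Tactic.RingSolver using (solve)
open import Data.Bool using (Bool; true; false; not; T; if_then_else_)
open import Data.Bool.ListAction using (any)
open import Data.Empty using (⊥-elim)
open import Data.Fin using (Fin)
open import Data.Integer using (+_; +≤+) renaming (_≤_ to _≤ℤ_; _-_ to _-ℤ_)
import Data.Integer.Properties as ℤ
open import Data.List using (List; []; _∷_; length; filter; filterᵇ)
open import Data.List.Membership.Propositional using (_∈_; _∉_)
open import Data.List.Membership.Propositional.Properties using (∈-filter⁺; ∈-filter⁻)
open import Data.List.Membership.DecPropositional _≟_ using (_∈?_)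
open import Data.List.Properties using (filter-all)
open import Data.List.Relation.Unary.All as All using (All)
open import Data.List.Relation.Unary.Any as Any using (here; there)
open import Data.List.Relation.Unary.Any.Properties using (any⁺)
open import Data.List.Relation.Unary.AllPairs using ([]; _∷_)
open import Data.List.Relation.Unary.Unique.Propositional using (Unique)
open import Data.List.Relation.Unary.Unique.Propositional.Properties using (filter⁺)
open import Data.Product using (_×_; _,_; proj₁; proj₂; map₂)
open import Data.Rational using (ℚ; 0ℚ; _/_) renaming (_<_ to _<ℚ_)
open import Function using (_∘_)
open import Function.Bundles using (_⇔_; Equivalence)
open import Relation.Binary.Definitions using (DecidableEquality)
open import Relation.Binary.PropositionalEquality
open import Relation.Nullary using (¬_; yes; no; ¬?)
open import Relation.Nullary.Decidable using (T?)

accumulate-≤ : ∀ j j′ d d′ q q′ p w → j + d′ + q ≤ suc (j′ + d + q′) →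
               j′ + d + p ≤ q + w → j + d′ + p ≤ q′ + suc w
accumulate-≤ j j′ d d′ q q′ p w step ih = +-cancelʳ-≤ q _ _ (begin
  j + d′ + p + q          ≡⟨ solve (j ∷ d′ ∷ q ∷ p ∷ []) ⟩
  j + d′ + q + p          ≤⟨ +-monoˡ-≤ p step ⟩
  suc (j′ + d + q′) + p   ≡⟨ solve (j′ ∷ d ∷ q′ ∷ p ∷ []) ⟩
  suc (q′ + (j′ + d + p)) ≤⟨ s≤s (+-monoʳ-≤ q′ ih) ⟩
  suc (q′ + (q + w))      ≡⟨ solve (q′ ∷ q ∷ w ∷ []) ⟩
  q′ + suc w + q          ∎)
  where open ≤-Reasoning

module _ {A : Set} where

  length-filterᵇ-mono : ∀ (p q : A → Bool) xs → (∀ {x} → x ∈ xs → T (p x) → T (q x)) →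
                        length (filterᵇ p xs) ≤ length (filterᵇ q xs)
  length-filterᵇ-mono p q [] _ = z≤n
  length-filterᵇ-mono p q (x ∷ xs) p⇒q with p x | q x | p⇒q (here refl)
  ... | true  | true  | _  = s≤s (length-filterᵇ-mono p q xs (p⇒q ∘ there))
  ... | true  | false | pq = ⊥-elim (pq _)
  ... | false | true  | _  = m≤n⇒m≤1+n (length-filterᵇ-mono p q xs (p⇒q ∘ there))
  ... | false | false | _  = length-filterᵇ-mono p q xs (p⇒q ∘ there)

  -- Where p x holds but q x fails, x must be y, so uniqueness keeps y out of the
  -- tail; no decidable equality is needed.
  length-filterᵇ-≤-suc : ∀ (p q : A → Bool) y {xs} → Unique xs →
                         (∀ {x} → x ∈ xs → ¬ x ≡ y → T (p x) → T (q x)) →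
                         length (filterᵇ p xs) ≤ suc (length (filterᵇ q xs))
  length-filterᵇ-≤-suc p q y [] _ = z≤n
  length-filterᵇ-≤-suc p q y {x ∷ xs} (x∉xs ∷ u) p⇒q with p x | q x | p⇒q (here refl)
  ... | true  | true  | _  = s≤s (length-filterᵇ-≤-suc p q y u (p⇒q ∘ there))
  ... | true  | false | pq = s≤s (length-filterᵇ-mono p q xs λ z∈xs →
                               p⇒q (there z∈xs) λ z≡y →
                                 pq (λ x≡y → All.lookup x∉xs z∈xs (trans x≡y (sym z≡y))) _)
  ... | false | true  | _  = m≤n⇒m≤1+n (length-filterᵇ-≤-suc p q y u (p⇒q ∘ there))
  ... | false | false | _  = length-filterᵇ-≤-suc p q y u (p⇒q ∘ there)

module _ {A : Set} (_≟_ : DecidableEquality A) where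

  without : A → List A → List A
  without y = filter (λ x → ¬? (x ≟ y))

  without-∉ : ∀ {y xs} → y ∉ xs → without y xs ≡ xs
  without-∉ y∉xs = filter-all _ (All.tabulate λ x∈xs x≡y → y∉xs (subst (_∈ _) x≡y x∈xs))

  length-≤-suc-without : ∀ y {xs} → Unique xs → length xs ≤ suc (length (without y xs))
  length-≤-suc-without y [] = z≤n
  length-≤-suc-without y {x ∷ xs} (x∉xs ∷ u) with x ≟ y
  ... | yes refl = s≤s (≤-reflexive (cong length (sym (without-∉ λ x∈xs → All.lookup x∉xs x∈xs refl))))
  ... | no _     = s≤s (length-≤-suc-without y u)

module NeighbourColours {X : Set} (colour : X → ℕ) (P : List ℕ)
                        (P-unique : Unique P) (P-nonzero : All (λ c → ¬ c ≡ 0) P) where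

  occurs : ℕ → List X → Bool
  occurs c ws = any (λ w → colour w ≡ᵇ c) ws

  count : ℕ → List X → ℕ
  count c ws = length (filterᵇ (λ w → colour w ≡ᵇ c) ws)

  freeColours : List X → List ℕ
  freeColours ws = filterᵇ (λ c → not (occurs c ws)) P

  GoodColour : List X → ℕ → Set
  GoodColour ws c = (¬ c ≡ 0) × (1 + (if any (c ≡ᵇ_) P then 1 else 0) ≤ count c ws)

  free : List X → ℕ
  free ws = length (freeColours ws)

  count-cons-≢ : ∀ {c x} ws → ¬ c ≡ colour x → count c (x ∷ ws) ≡ count c ws
  count-cons-≢ {c} {x} ws c≢x with colour x ≡ᵇ c | ≡ᵇ⇒≡ (colour x) c
  ... | false | _  = refl
  ... | true  | eq = ⊥-elim (c≢x (sym (eq _)))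

  count-cons-self : ∀ x ws → count (colour x) (x ∷ ws) ≡ suc (count (colour x) ws)
  count-cons-self x ws with colour x ≡ᵇ colour x | ≡⇒≡ᵇ (colour x) (colour x) refl
  ... | true | _ = refl

  count-≡0 : ∀ {c} ws → T (not (occurs c ws)) → count c ws ≡ 0
  count-≡0 [] _ = refl
  count-≡0 {c} (w ∷ ws) unseen with colour w ≡ᵇ c
  ... | false = count-≡0 ws unseen

  unseen-cons : ∀ {c x} ws → ¬ c ≡ colour x → T (not (occurs c ws)) → T (not (occurs c (x ∷ ws)))
  unseen-cons {c} {x} ws c≢x unseen with colour x ≡ᵇ c | ≡ᵇ⇒≡ (colour x) c
  ... | false | _  = unseen
  ... | true  | eq = ⊥-elim (c≢x (sym (eq _)))

  freeColour⁺ : ∀ {c} ws → c ∈ P → T (not (occurs c ws)) → c ∈ freeColours ws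
  freeColour⁺ ws = ∈-filter⁺ (T? ∘ λ c → not (occurs c ws))

  freeColour⁻ : ∀ {c} ws → c ∈ freeColours ws → c ∈ P × T (not (occurs c ws))
  freeColour⁻ ws = ∈-filter⁻ (T? ∘ λ c → not (occurs c ws))

  good-cons : ∀ {c x ws} → ¬ c ≡ colour x → GoodColour (x ∷ ws) c → GoodColour ws c
  good-cons {ws = ws} c≢x = map₂ (subst (_ ≤_) (count-cons-≢ ws c≢x))

  good-palette-colour : ∀ {c} ws → c ∈ P → GoodColour ws c → 2 ≤ count c ws
  good-palette-colour {c} ws c∈P (_ , seen)
    with any (c ≡ᵇ_) P | any⁺ (c ≡ᵇ_) (Any.map (≡⇒≡ᵇ c _) c∈P)
  ... | true | _ = seen

  free-mono : ∀ x ws → colour x ∉ freeColours ws → free ws ≤ free (x ∷ ws)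
  free-mono x ws x∉F = length-filterᵇ-mono _ _ P λ c∈P unseen →
    unseen-cons ws (λ c≡x → x∉F (subst (_∈ _) c≡x (freeColour⁺ ws c∈P unseen))) unseen

  free-≤-suc : ∀ x ws → free ws ≤ suc (free (x ∷ ws))
  free-≤-suc x ws = length-filterᵇ-≤-suc _ _ (colour x) P-unique λ _ → unseen-cons ws

  -- At most one of the three summands on the left exceeds its counterpart, by one.
  potential-step : ∀ x ws {J} → Unique J → (∀ {c} → c ∈ J → GoodColour (x ∷ ws) c) →
    length J + count 0 (x ∷ ws) + free ws
      ≤ suc (length (without _≟_ (colour x) J) + count 0 ws + free (x ∷ ws))
  potential-step x ws {J} J-unique good
    with colour x ≟ 0 | colour x ∈? freeColours ws
  ... | yes x≡0 | _ = begin
    length J  + count 0 (x ∷ ws) + free ws       ≡⟨ cong₂ (λ j d → j + d + free ws) J≡J′ count≡ ⟩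
    length J′ + suc (count 0 ws) + free ws       ≤⟨ +-monoʳ-≤ _ (free-mono x ws x∉F) ⟩
    length J′ + suc (count 0 ws) + free (x ∷ ws) ≡⟨ cong (_+ free (x ∷ ws)) (+-suc (length J′) _) ⟩
    suc (length J′ + count 0 ws + free (x ∷ ws)) ∎
    where
      open ≤-Reasoning
      J′ : List ℕ
      J′ = without _≟_ (colour x) J
      J≡J′ : length J ≡ length J′
      J≡J′ = cong length (sym (without-∉ _≟_ λ x∈J → proj₁ (good x∈J) x≡0))
      count≡ : count 0 (x ∷ ws) ≡ suc (count 0 ws)
      count≡ = subst (λ c → count c (x ∷ ws) ≡ suc (count c ws)) x≡0 (count-cons-self x ws)
      x∉F : colour x ∉ freeColours ws
      x∉F x∈F = All.lookup P-nonzero (proj₁ (freeColour⁻ ws x∈F)) x≡0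
  ... | no x≢0 | yes x∈F = begin
    length J  + count 0 (x ∷ ws) + free ws       ≡⟨ cong₂ (λ j d → j + d + free ws) J≡J′ count≡ ⟩
    length J′ + count 0 ws + free ws             ≤⟨ +-monoʳ-≤ _ (free-≤-suc x ws) ⟩
    length J′ + count 0 ws + suc (free (x ∷ ws)) ≡⟨ +-suc _ (free (x ∷ ws)) ⟩
    suc (length J′ + count 0 ws + free (x ∷ ws)) ∎
    where
      open ≤-Reasoning
      J′ : List ℕ
      J′ = without _≟_ (colour x) J
      count≡ : count 0 (x ∷ ws) ≡ count 0 ws
      count≡ = count-cons-≢ ws (x≢0 ∘ sym)
      seen-once : count (colour x) (x ∷ ws) ≡ 1
      seen-once = trans (count-cons-self x ws) (cong suc (count-≡0 ws (proj₂ (freeColour⁻ ws x∈F))))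
      x∉J : colour x ∉ J
      x∉J x∈J with subst (2 ≤_) seen-once
                     (good-palette-colour (x ∷ ws) (proj₁ (freeColour⁻ ws x∈F)) (good x∈J))
      ... | s≤s ()
      J≡J′ : length J ≡ length J′
      J≡J′ = cong length (sym (without-∉ _≟_ x∉J))
  ... | no x≢0 | no x∉F =
    +-mono-≤ (+-mono-≤ (length-≤-suc-without _≟_ (colour x) J-unique)
                       (≤-reflexive (count-cons-≢ ws (x≢0 ∘ sym))))
             (free-mono x ws x∉F)

  good+blank+palette≤free+deg : ∀ ws {J} → Unique J → (∀ {c} → c ∈ J → GoodColour ws c) →
           length J + count 0 ws + length P ≤ free ws + length ws
  good+blank+palette≤free+deg [] {[]} _ _ = ≤-reflexive (begin
    length P                 ≡⟨ cong length (sym (filter-all _ (All.universal _ P))) ⟩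
    free []                  ≡⟨ sym (+-identityʳ _) ⟩
    free [] + 0              ∎)
    where open ≡-Reasoning
  good+blank+palette≤free+deg [] {c ∷ _} _ good with good (here refl)
  ... | _ , ()
  good+blank+palette≤free+deg (x ∷ ws) {J} J-unique good =
    accumulate-≤ (length J) (length J′) (count 0 ws) (count 0 (x ∷ ws)) (free ws) (free (x ∷ ws)) _ _
      (potential-step x ws J-unique good)
      (good+blank+palette≤free+deg ws (filter⁺ (λ c → ¬? (c ≟ colour x)) J-unique) λ c∈J′ →
        let c∈J , c≢x = ∈-filter⁻ _ c∈J′ in good-cons c≢x (good c∈J))
    where
      J′ : List ℕ
      J′ = without _≟_ (colour x) J

  good+blank≤free : ∀ ws {J} → length ws ≤ length P → Unique J →
                    (∀ {c} → c ∈ J → GoodColour ws c) → length J + count 0 ws ≤ free ws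
  good+blank≤free ws ws≤P J-unique good =
    +-cancelʳ-≤ (length P) _ _
      (≤-trans (good+blank+palette≤free+deg ws J-unique good) (+-monoʳ-≤ _ ws≤P))

m+n≤o⇒+m≤+o-+n : ∀ {m n o} → m + n ≤ o → + m ≤ℤ + o -ℤ + n
m+n≤o⇒+m≤+o-+n {m} {n} {o} m+n≤o =
  subst (+ m ≤ℤ_) (sym (trans (ℤ.m-n≡m⊖n o n) (ℤ.⊖-≥ (≤-trans (m≤n+m n m) m+n≤o))))
        (+≤+ (m+n≤o⇒m≤o∸n m m+n≤o))

mainTheorem4 : ∀ {n : ℕ} (G : Graph n) (Δ : ℕ) (pal : Fin n → List ℕ) (ε : ℚ) →
    IsMaxDegree G Δ → ValidPalettes G Δ pal →
    0ℚ <ℚ ε → ε <ℚ (+ 1 / 5) →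
    (v : Fin n) → Sparse G ε Δ v →
    (A : Fin n → ℕ) → InSupport G pal A →
    (J : List ℕ) → Unique J → (∀ c → (c ∈ J) ⇔ Good G pal A v c) →
    + length J ≤ℤ S₀ G pal A v
mainTheorem4 G Δ pal ε (deg≤Δ , _) palettes _ _ v _ A _ J J-unique J-good =
  m+n≤o⇒+m≤+o-+n (good+blank≤free (nbrs G v) deg≤|P| J-unique (Equivalence.to (J-good _)))
  where
    open NeighbourColours (χ G A) (pal v) (proj₁ (palettes v)) (proj₂ (proj₂ (palettes v)))
    deg≤|P| : deg G v ≤ length (pal v)
    deg≤|P| = ≤-trans (deg≤Δ v) (subst (Δ ≤_) (sym (proj₁ (proj₂ (palettes v)))) (n≤1+n Δ))
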